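{- For any time warps $f$ and $g$: $\mathrm{last}(f\circ g)=\omega$ if and only if $\mathrm{last}(g)=\mathrm{last}(f)=\omega$; and $\mathrm{last}(f')=\omega$ if and only if $\mathrm{last}(f)=\omega$.
   Context: Let $\omega^+=\omega\cup\{\omega\}$ with its natural order. A time warp is a join-preserving map $f\colon\omega^+\to\omega^+$ (equivalently, order-preserving with $f(0)=0$ and $f(\omega)=\sup_{n\in\omega}f(n)$). Let $p$ be the predecessor time warp ($p(0)=0$, $p(\omega)=\omega$, $p(m)=m-1$ for $0<m<\omega$); $f'$ is the largest time warp $g$ with $f\circ g\le p$ pointwise. For a time warp $f$, $\mathrm{last}(f)=\min\{m\in\omega^+\mid f(m)=f(\omega)\}$. -}

module Defs where

open import Data.Nat using (ℕ; zero; suc; _∸_) renaming (_≤_ to _≤ℕ_)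
open import Data.Product using (_×_)
open import Relation.Binary.PropositionalEquality using (_≡_)

data Ω⁺ : Set where
  fin : ℕ → Ω⁺
  ω   : Ω⁺

data _≤_ : Ω⁺ → Ω⁺ → Set where
  fin≤fin : ∀ {m n} → m ≤ℕ n → fin m ≤ fin n
  x≤ω     : ∀ {x} → x ≤ ω

IsSup : (ℕ → Ω⁺) → Ω⁺ → Set
IsSup s x = (∀ n → s n ≤ x) × (∀ u → (∀ n → s n ≤ u) → x ≤ u)

IsTimeWarp : (Ω⁺ → Ω⁺) → Set
IsTimeWarp f =
  (∀ x y → x ≤ y → f x ≤ f y) × (f (fin 0) ≡ fin 0) × IsSup (λ n → f (fin n)) (f ω)

p : Ω⁺ → Ω⁺
p (fin m) = fin (m ∸ 1)
p ω = ω

_≤ᶠ_ : (Ω⁺ → Ω⁺) → (Ω⁺ → Ω⁺) → Set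
f ≤ᶠ g = ∀ x → f x ≤ g x

IsPrime : (Ω⁺ → Ω⁺) → (Ω⁺ → Ω⁺) → Set
IsPrime f h =
  IsTimeWarp h × ((λ x → f (h x)) ≤ᶠ p) ×
  (∀ g → IsTimeWarp g → (λ x → f (g x)) ≤ᶠ p → g ≤ᶠ h)

IsLast : (Ω⁺ → Ω⁺) → Ω⁺ → Set
IsLast f m = (f m ≡ f ω) × (∀ k → f k ≡ f ω → m ≤ k)

-- last(f) = ω says that f attains f(ω) only at ω; for a time warp this forces
-- f(ω) = ω, since a finite supremum of a sequence in ω⁺ is attained.  Hence f is
-- unbounded on ω, and if a monotone h attains h(ω) at a finite point m, then
-- h ∘ f attains h(ω) = h(f(ω)) at a finite point too, as f eventually exceeds m.  For f′ the
-- tool is the warp that is 0 up to a and v afterwards: when f(v) ≤ a it lies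
-- below p after f, so by maximality it lies below f′.
module Submission where

open import Defs
open import Data.Product using (_×_; _,_; proj₁)
open import Data.Sum using (_⊎_; inj₁; inj₂)
open import Data.Empty using (⊥; ⊥-elim)
open import Function using (_∘_; _⇔_; mk⇔)
open import Data.Nat using (ℕ; zero; suc; _∸_; z≤n)
import Data.Nat.Properties as ℕ
open import Relation.Nullary using (¬_; yes; no)
open import Relation.Binary.PropositionalEquality
  using (_≡_; _≢_; refl; sym; trans; cong; subst)

≤-refl : ∀ {x} → x ≤ x
≤-refl {fin n} = fin≤fin ℕ.≤-refl
≤-refl {ω}     = x≤ω

≤-trans : ∀ {x y z} → x ≤ y → y ≤ z → x ≤ z
≤-trans (fin≤fin m≤n) (fin≤fin n≤k) = fin≤fin (ℕ.≤-trans m≤n n≤k)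
≤-trans _             x≤ω           = x≤ω

≤-antisym : ∀ {x y} → x ≤ y → y ≤ x → x ≡ y
≤-antisym (fin≤fin m≤n) (fin≤fin n≤m) = cong fin (ℕ.≤-antisym m≤n n≤m)
≤-antisym x≤ω           x≤ω           = refl

≤-total : ∀ x y → x ≤ y ⊎ y ≤ x
≤-total (fin m) (fin n) with ℕ.≤-total m n
... | inj₁ m≤n = inj₁ (fin≤fin m≤n)
... | inj₂ n≤m = inj₂ (fin≤fin n≤m)
≤-total x       ω       = inj₁ x≤ω
≤-total ω       y       = inj₂ x≤ω

fin0≤ : ∀ x → fin 0 ≤ x
fin0≤ (fin n) = fin≤fin z≤n
fin0≤ ω       = x≤ω

ω≰fin : ∀ {n} → ¬ ω ≤ fin n
ω≰fin ()

fin≢ω : ∀ {n} → fin n ≢ ω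
fin≢ω ()

ω≤⇒≡ω : ∀ {x} → ω ≤ x → x ≡ ω
ω≤⇒≡ω x≤ω = refl

≤-pred-≢ : ∀ {x m} → x ≤ fin (suc m) → x ≢ fin (suc m) → x ≤ fin m
≤-pred-≢ (fin≤fin x≤1+m) x≢1+m with ℕ.m≤n⇒m<n∨m≡n x≤1+m
... | inj₁ x<1+m = fin≤fin (ℕ.≤-pred x<1+m)
... | inj₂ x≡1+m = ⊥-elim (x≢1+m (cong fin x≡1+m))

finite-sup-attained : ∀ {s m} → IsSup s (fin m) → ¬ (∀ n → s n ≢ fin m)
finite-sup-attained {m = zero}  (upper , _) s≢m =
  s≢m 0 (≤-antisym (upper 0) (fin0≤ _))
finite-sup-attained {m = suc m} (upper , least) s≢m
  with least (fin m) (λ n → ≤-pred-≢ (upper n) (s≢m n))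
... | fin≤fin 1+m≤m = ℕ.<-irrefl refl 1+m≤m

ω-sup-unbounded : ∀ {s m} → IsSup s ω → ¬ (∀ n → s n ≤ fin m)
ω-sup-unbounded (_ , least) s≤m = ω≰fin (least _ s≤m)

Monotone : (Ω⁺ → Ω⁺) → Set
Monotone f = ∀ x y → x ≤ y → f x ≤ f y

top-upward-closed : ∀ {f x y} → Monotone f → f x ≡ f ω → x ≤ y → f y ≡ f ω
top-upward-closed {f} {x} {y} mono fx≡fω x≤y =
  ≤-antisym (mono y ω x≤ω) (subst (_≤ f y) fx≡fω (mono x y x≤y))

isLastω-elim : ∀ {f x} → IsLast f ω → f x ≡ f ω → x ≡ ω
isLastω-elim (_ , least) fx≡fω = ω≤⇒≡ω (least _ fx≡fω)

isLastω-intro : ∀ {f} → (∀ x → f x ≡ f ω → x ≡ ω) → IsLast f ω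
isLastω-intro only-ω = refl , λ x fx≡fω → subst (ω ≤_) (sym (only-ω x fx≡fω)) x≤ω

isLastω⇒ω : ∀ {f} → IsSup (λ n → f (fin n)) (f ω) → IsLast f ω → f ω ≡ ω
isLastω⇒ω {f} sup last = top-not-fin (f ω) refl
  where
  top-not-fin : ∀ x → f ω ≡ x → x ≡ ω
  top-not-fin ω       _      = refl
  top-not-fin (fin m) fω≡m = ⊥-elim (finite-sup-attained (subst (IsSup _) fω≡m sup)
    λ n fn≡m → fin≢ω (isLastω-elim last (trans fn≡m (sym fω≡m))))

unbounded-reaches-top : ∀ (f g : Ω⁺ → Ω⁺) {m} → Monotone f → IsSup (λ n → g (fin n)) ω →
  f (fin m) ≡ f ω → ¬ (∀ n → f (g (fin n)) ≢ f ω)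
unbounded-reaches-top f g {m} mono sup fm≡fω misses =
  ω-sup-unbounded sup below-m
  where
  below-m : ∀ n → g (fin n) ≤ fin m
  below-m n with ≤-total (g (fin n)) (fin m)
  ... | inj₁ gn≤m = gn≤m
  ... | inj₂ m≤gn = ⊥-elim (misses n (top-upward-closed mono fm≡fω m≤gn))

isLastω-∘ : ∀ (f g : Ω⁺ → Ω⁺) → Monotone f → IsTimeWarp g →
  IsLast (f ∘ g) ω ⇔ (IsLast g ω × IsLast f ω)
isLastω-∘ f g mono-f (_ , _ , sup-g) = mk⇔ split join
  where
  split : IsLast (f ∘ g) ω → IsLast g ω × IsLast f ω
  split last-fg = last-g , isLastω-intro f-only-ω
    where
    last-g : IsLast g ω
    last-g = isLastω-intro λ x gx≡gω → isLastω-elim last-fg (cong f gx≡gω)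
    gω≡ω : g ω ≡ ω
    gω≡ω = isLastω⇒ω sup-g last-g
    f-only-ω : ∀ x → f x ≡ f ω → x ≡ ω
    f-only-ω ω     _      = refl
    f-only-ω (fin m) fm≡fω = ⊥-elim (unbounded-reaches-top f g mono-f
      (subst (IsSup _) gω≡ω sup-g) fm≡fω
      λ n fgn≡fω → fin≢ω (isLastω-elim last-fg (trans fgn≡fω (cong f (sym gω≡ω)))))
  join : IsLast g ω × IsLast f ω → IsLast (f ∘ g) ω
  join (last-g , last-f) = isLastω-intro λ x fgx≡fgω →
    isLastω-elim last-g (trans (isLastω-elim last-f (trans fgx≡fgω (cong f gω≡ω)))
                               (sym gω≡ω))
    where
    gω≡ω : g ω ≡ ω
    gω≡ω = isLastω⇒ω sup-g last-g

jump : ℕ → Ω⁺ → Ω⁺ → Ω⁺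
jump a v (fin k) with k ℕ.≤? a
... | yes _ = fin 0
... | no  _ = v
jump a v ω = v

jump-≤ : ∀ a v x → jump a v x ≤ v
jump-≤ a v (fin k) with k ℕ.≤? a
... | yes _ = fin0≤ v
... | no  _ = ≤-refl
jump-≤ a v ω = ≤-refl

jump-suc : ∀ a v → jump a v (fin (suc a)) ≡ v
jump-suc a v with suc a ℕ.≤? a
... | yes 1+a≤a = ⊥-elim (ℕ.<-irrefl refl 1+a≤a)
... | no  _     = refl

jump-isTimeWarp : ∀ a v → IsTimeWarp (jump a v)
jump-isTimeWarp a v =
  mono , jump-0 , (λ n → jump-≤ a v (fin n)) ,
  (λ u jump≤u → subst (_≤ u) (jump-suc a v) (jump≤u (suc a)))
  where
  mono : Monotone (jump a v)
  mono (fin k) (fin l) (fin≤fin k≤l) with k ℕ.≤? a | l ℕ.≤? a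
  ... | yes _   | yes _   = ≤-refl
  ... | yes _   | no  _   = fin0≤ v
  ... | no  k≰a | yes l≤a = ⊥-elim (k≰a (ℕ.≤-trans k≤l l≤a))
  ... | no  _   | no  _   = ≤-refl
  mono x ω x≤ω = jump-≤ a v x
  jump-0 : jump a v (fin 0) ≡ fin 0
  jump-0 with 0 ℕ.≤? a
  ... | yes _   = refl
  ... | no  0≰a = ⊥-elim (0≰a z≤n)

jump-below-p : ∀ f a v → f (fin 0) ≡ fin 0 → f v ≤ fin a → (f ∘ jump a v) ≤ᶠ p
jump-below-p f a v f0≡0 fv≤a (fin k) with k ℕ.≤? a
... | yes _   = subst (_≤ fin (k ∸ 1)) (sym f0≡0) (fin0≤ _)
... | no  k≰a = ≤-trans fv≤a (fin≤fin (ℕ.pred-mono-≤ (ℕ.≰⇒> k≰a)))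
jump-below-p f a v f0≡0 fv≤a ω = x≤ω

jump-≤-prime : ∀ (f f′ : Ω⁺ → Ω⁺) a v → IsPrime f f′ → f (fin 0) ≡ fin 0 →
  f v ≤ fin a → jump a v ≤ᶠ f′
jump-≤-prime f f′ a v (_ , _ , largest) f0≡0 fv≤a =
  largest (jump a v) (jump-isTimeWarp a v) (jump-below-p f a v f0≡0 fv≤a)

prime-ω-after-bound : ∀ (f f′ : Ω⁺ → Ω⁺) n → IsPrime f f′ → f (fin 0) ≡ fin 0 →
  f ω ≤ fin n → f′ (fin (suc n)) ≡ ω
prime-ω-after-bound f f′ n prime f0≡0 fω≤n = ω≤⇒≡ω (subst (_≤ f′ (fin (suc n)))
  (jump-suc n ω) (jump-≤-prime f f′ n ω prime f0≡0 fω≤n (fin (suc n))))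

-- f′(ω) = m is impossible: f(m + 1) is finite, say a, so the jump from 0 to
-- m + 1 after a lies below f′, giving m + 1 ≤ f′(ω).
prime-isLastω⇒ω : ∀ (f f′ : Ω⁺ → Ω⁺) → IsTimeWarp f → IsPrime f f′ →
  IsLast f ω → f′ ω ≡ ω
prime-isLastω⇒ω f f′ (_ , f0≡0 , sup-f) prime last-f = top-not-fin (f′ ω) refl
  where
  fω≡ω : f ω ≡ ω
  fω≡ω = isLastω⇒ω sup-f last-f
  top-not-fin : ∀ x → f′ ω ≡ x → x ≡ ω
  top-not-fin ω       _       = refl
  top-not-fin (fin m) f′ω≡m = ⊥-elim (f-finite (f (fin (suc m))) refl)
    where
    f-finite : ∀ y → f (fin (suc m)) ≡ y → ⊥
    f-finite ω       f1+m≡ω = fin≢ω (isLastω-elim last-f (trans f1+m≡ω (sym fω≡ω)))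
    f-finite (fin a) f1+m≡a
      with subst (fin (suc m) ≤_) f′ω≡m
             (jump-≤-prime f f′ a (fin (suc m)) prime f0≡0
               (subst (_≤ fin a) (sym f1+m≡a) ≤-refl) ω)
    ... | fin≤fin 1+m≤m = ℕ.<-irrefl refl 1+m≤m

isLastω-prime : ∀ (f f′ : Ω⁺ → Ω⁺) → IsTimeWarp f → IsPrime f f′ →
  IsLast f′ ω ⇔ IsLast f ω
isLastω-prime f f′ warp-f@(mono-f , f0≡0 , sup-f)
                   prime@((_ , _ , sup-f′) , f∘f′≤p , _) = mk⇔ to from
  where
  to : IsLast f′ ω → IsLast f ω
  to last-f′ = isLastω-intro f-only-ω
    where
    f′ω≡ω : f′ ω ≡ ω
    f′ω≡ω = isLastω⇒ω sup-f′ last-f′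
    fω≤n : ∀ n → f (f′ (fin n)) ≡ f ω → f ω ≤ fin n
    fω≤n n ff′n≡fω =
      ≤-trans (subst (_≤ _) ff′n≡fω (f∘f′≤p (fin n))) (fin≤fin (ℕ.m∸n≤m n 1))
    f-only-ω : ∀ x → f x ≡ f ω → x ≡ ω
    f-only-ω ω       _     = refl
    f-only-ω (fin m) fm≡fω = ⊥-elim (unbounded-reaches-top f f′ mono-f
      (subst (IsSup _) f′ω≡ω sup-f′) fm≡fω
      λ n ff′n≡fω → fin≢ω (isLastω-elim last-f′
        (trans (prime-ω-after-bound f f′ n prime f0≡0 (fω≤n n ff′n≡fω)) (sym f′ω≡ω))))
  from : IsLast f ω → IsLast f′ ω
  from last-f = isLastω-intro f′-only-ω
    where
    ff′ω≡ω : f (f′ ω) ≡ ω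
    ff′ω≡ω = trans (cong f (prime-isLastω⇒ω f f′ warp-f prime last-f))
                   (isLastω⇒ω sup-f last-f)
    f′-only-ω : ∀ x → f′ x ≡ f′ ω → x ≡ ω
    f′-only-ω ω       _       = refl
    f′-only-ω (fin n) f′n≡f′ω = ⊥-elim (ω≰fin
      (subst (_≤ fin (n ∸ 1)) (trans (cong f f′n≡f′ω) ff′ω≡ω) (f∘f′≤p (fin n))))

lemma2p6 :
    (∀ (f g : Ω⁺ → Ω⁺) → IsTimeWarp f → IsTimeWarp g →
      (IsLast (f ∘ g) ω ⇔ (IsLast g ω × IsLast f ω)))
    ×
    (∀ (f f′ : Ω⁺ → Ω⁺) → IsTimeWarp f → IsPrime f f′ →
      (IsLast f′ ω ⇔ IsLast f ω))
lemma2p6 = (λ f g warp-f → isLastω-∘ f g (proj₁ warp-f)) , isLastω-prime
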